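{- For every positive integer $k$, $$\frac{h_k}{k}=\binom{2k}{k}\frac{1}{4^k}\sum_{i=1}^{\infty}\frac{h_i}{i+k}\binom{2i}{i}\frac{1}{4^i},$$ where $h_m=\sum_{j=1}^{m}\frac{1}{2j-1}$.
   Context: $h_m=\sum_{j=1}^{m}\frac{1}{2j-1}$ denotes the $m$-th odd harmonic number. -}

module Defs where

open import Data.Nat as ℕ using (ℕ; zero; suc; NonZero)
open import Data.Nat.Properties using (m^n≢0)
open import Data.Nat.Combinatorics using (_C_)
open import Data.Integer using (+_)
open import Data.Rational using (ℚ; 0ℚ; _+_; _*_; _-_; _/_; ∣_∣; _<_; _≤_)
open import Data.Product using (∃-syntax)

-- odd harmonic number h_m = Σ_{j=1}^m 1/(2j-1)   (term j = t+1 has 2j-1 = 2t+1)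
oddH : ℕ → ℚ
oddH zero    = 0ℚ
oddH (suc t) = oddH t + (+ 1 / suc (2 ℕ.* t))

cbw : ℕ → ℚ
cbw i = (+ ((2 ℕ.* i) C i) / (4 ℕ.^ i)) {{m^n≢0 4 i}}

-- summand of the series for index i = suc m  (i ≥ 1):  h_i/(i+k) * C(2i,i)/4^i
term : ℕ → ℕ → ℚ
term k m = oddH (suc m) * (+ 1 / (suc m ℕ.+ k)) * cbw (suc m)

partialSum : ℕ → ℕ → ℚ
partialSum k zero    = 0ℚ
partialSum k (suc n) = partialSum k n + term k n

SumsTo : (ℕ → ℚ) → ℚ → Set
SumsTo S L = ∀ (ε : ℚ) → 0ℚ < ε → ∃[ N ] (∀ n → N ℕ.≤ n → ∣ S n - L ∣ < ε)

module Submission where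

-- Write c_i = C(2i,i)/4^i, so that (2i+2) c_(i+1) = (2i+1) c_i, and for fixed n let
-- A_k = k c_k Σ_(i≤n) c_i/(i+k) and S_k = k c_k Σ_(i≤n) h_i c_i/(i+k). Passing from k to k+1
-- changes the i-th summand of A by a difference of consecutive boundary terms b_k(i) = c_k c_i i/(i+k),
-- so A telescopes in i. In S the same differences carry the weight h_i, and summation by parts
-- returns, through h_(i+1) - h_i = 1/(2i+1), exactly the summands of A_(k+1)/(2k+1). Induction on k
-- then gives the exact identities A_k = 1 - c_k - Σ_(j<k) b_j(n+1) and S_k = h_k - R_k with
-- 0 ≤ R_k ≤ 2k h_(n+1) c_(n+1). Hence S_k/k, the n-th partial sum of the right-hand side, is within
-- 2 h_(n+1) c_(n+1) of h_k/k, and this tends to 0 because c_t² (2t+1) ≤ 1 while h_t grows like log t.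

open import Defs

module CentralBinomial where

  open import Data.Nat
  open import Data.Nat.Combinatorics using (_C_; nCk+nC[k+1]≡[n+1]C[k+1]; nC1≡n; nCk≡nC[n∸k])
  open import Data.Nat.Properties
  open import Data.Nat.Tactic.RingSolver
  open import Relation.Binary.PropositionalEquality
  open import Relation.Nullary using (yes; no)
  open import Relation.Nullary.Negation using (contradiction)
  open ≤-Reasoning

  [1+k]*[1+n]C[1+k]≡[1+n]*nCk : ∀ n k → suc k * (suc n C suc k) ≡ suc n * (n C k)
  [1+k]*[1+n]C[1+k]≡[1+n]*nCk zero    zero    = refl
  [1+k]*[1+n]C[1+k]≡[1+n]*nCk zero    (suc k) = *-zeroʳ (suc (suc k))
  [1+k]*[1+n]C[1+k]≡[1+n]*nCk (suc n) zero    =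
    trans (+-identityʳ _) (trans (nC1≡n (suc (suc n))) (sym (*-identityʳ _)))
  [1+k]*[1+n]C[1+k]≡[1+n]*nCk (suc n) (suc k) = begin-equality
    suc (suc k) * (suc (suc n) C suc (suc k))
      ≡⟨ cong (suc (suc k) *_) (nCk+nC[k+1]≡[n+1]C[k+1] (suc n) (suc k)) ⟨
    suc (suc k) * (a + b)
      ≡⟨ split a b k ⟩
    suc k * a + suc (suc k) * b + a
      ≡⟨ cong₂ (λ x y → x + y + a) ([1+k]*[1+n]C[1+k]≡[1+n]*nCk n k) ([1+k]*[1+n]C[1+k]≡[1+n]*nCk n (suc k)) ⟩
    suc n * (n C k) + suc n * (n C suc k) + a
      ≡⟨ cong (_+ a) (*-distribˡ-+ (suc n) (n C k) (n C suc k)) ⟨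
    suc n * (n C k + n C suc k) + a
      ≡⟨ cong (λ x → suc n * x + a) (nCk+nC[k+1]≡[n+1]C[k+1] n k) ⟩
    suc n * a + a
      ≡⟨ +-comm (suc n * a) a ⟩
    suc (suc n) * a ∎
    where
    a = suc n C suc k
    b = suc n C suc (suc k)
    split : ∀ a b k → suc (suc k) * (a + b) ≡ suc k * a + suc (suc k) * b + a
    split = solve-∀

  central : ℕ → ℕ
  central n = (2 * n) C n

  central-suc : ∀ n → suc n * central (suc n) ≡ 2 * (suc (2 * n) * central n)
  central-suc n = begin-equality
    suc n * (2 * suc n C suc n)
      ≡⟨ cong (λ m → suc n * (m C suc n)) (2*[1+n]≡2+2n n) ⟩
    suc n * (suc (suc (2 * n)) C suc n)
      ≡⟨ cong (suc n *_) (nCk+nC[k+1]≡[n+1]C[k+1] (suc (2 * n)) n) ⟨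
    suc n * (suc (2 * n) C n + suc (2 * n) C suc n)
      ≡⟨ cong (λ x → suc n * (x + suc (2 * n) C suc n)) middle-symmetry ⟩
    suc n * (suc (2 * n) C suc n + suc (2 * n) C suc n)
      ≡⟨ double (suc n) (suc (2 * n) C suc n) ⟩
    2 * (suc n * (suc (2 * n) C suc n))
      ≡⟨ cong (2 *_) ([1+k]*[1+n]C[1+k]≡[1+n]*nCk (2 * n) n) ⟩
    2 * (suc (2 * n) * central n) ∎
    where
    2*[1+n]≡2+2n : ∀ n → 2 * suc n ≡ suc (suc (2 * n))
    2*[1+n]≡2+2n = solve-∀
    double : ∀ a b → a * (b + b) ≡ 2 * (a * b)
    double = solve-∀
    [1+2n]∸n≡1+n : suc (2 * n) ∸ n ≡ suc n
    [1+2n]∸n≡1+n = trans (cong (_∸ n) (lemma n)) (m+n∸n≡m (suc n) n)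
      where
      lemma : ∀ n → suc (2 * n) ≡ suc n + n
      lemma = solve-∀
    middle-symmetry : suc (2 * n) C n ≡ suc (2 * n) C suc n
    middle-symmetry = trans (nCk≡nC[n∸k] (≤-trans (m≤n*m n 2) (n≤1+n (2 * n))))
                            (cong (suc (2 * n) C_) [1+2n]∸n≡1+n)

  central²*[1+2n]≤16^n : ∀ n → central n * central n * suc (2 * n) ≤ 4 ^ n * 4 ^ n
  central²*[1+2n]≤16^n zero    = ≤-refl
  central²*[1+2n]≤16^n (suc n) = *-cancelˡ-≤ (suc n * suc n) (begin
    suc n * suc n * (c′ * c′ * suc (2 * suc n))
      ≡⟨ regroup (suc n) c′ (suc (2 * suc n)) ⟩
    (suc n * c′) * (suc n * c′) * suc (2 * suc n)
      ≡⟨ cong (λ x → x * x * suc (2 * suc n)) (central-suc n) ⟩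
    (2 * (suc (2 * n) * c)) * (2 * (suc (2 * n) * c)) * suc (2 * suc n)
      ≡⟨ factor c n ⟩
    4 * suc (2 * n) * suc (2 * suc n) * (c * c * suc (2 * n))
      ≤⟨ *-monoʳ-≤ (4 * suc (2 * n) * suc (2 * suc n)) (central²*[1+2n]≤16^n n) ⟩
    4 * suc (2 * n) * suc (2 * suc n) * (4 ^ n * 4 ^ n)
      ≤⟨ m≤m+n _ (4 * (4 ^ n * 4 ^ n)) ⟩
    4 * suc (2 * n) * suc (2 * suc n) * (4 ^ n * 4 ^ n) + 4 * (4 ^ n * 4 ^ n)
      ≡⟨ expand (4 ^ n) n ⟩
    suc n * suc n * (4 ^ suc n * 4 ^ suc n) ∎)
    where
    c  = central n
    c′ = central (suc n)
    regroup : ∀ s y u → s * s * (y * y * u) ≡ (s * y) * (s * y) * u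
    regroup = solve-∀
    factor : ∀ c n → (2 * (suc (2 * n) * c)) * (2 * (suc (2 * n) * c)) * suc (2 * suc n)
                   ≡ 4 * suc (2 * n) * suc (2 * suc n) * (c * c * suc (2 * n))
    factor = solve-∀
    expand : ∀ p n → 4 * suc (2 * n) * suc (2 * suc n) * (p * p) + 4 * (p * p)
                   ≡ suc n * suc n * ((4 * p) * (4 * p))
    expand = solve-∀

  square-cancel-< : ∀ x y → x * x < y * y → x < y
  square-cancel-< x y x²<y² with x <? y
  ... | yes x<y = x<y
  ... | no  x≮y = contradiction x²<y² (≤⇒≯ (*-mono-≤ (≮⇒≥ x≮y) (≮⇒≥ x≮y)))

  *-central<4^ : ∀ a m t → a * a * ((m + 3) * (m + 3)) < 2 ^ m → 2 ^ m ≤ t →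
                 a * (m + 3) * central t < 4 ^ t
  *-central<4^ a m t below 2^m≤t = square-cancel-< x (4 ^ t) (*-cancelʳ-< s (x * x) (4 ^ t * 4 ^ t) (begin-strict
    x * x * s                       ≡⟨ regroup a (m + 3) c s ⟩
    a * a * ((m + 3) * (m + 3)) * (c * c * s)
      ≤⟨ *-monoʳ-≤ (a * a * ((m + 3) * (m + 3))) (central²*[1+2n]≤16^n t) ⟩
    a * a * ((m + 3) * (m + 3)) * (4 ^ t * 4 ^ t)
      <⟨ *-monoˡ-< (4 ^ t * 4 ^ t) {{16^t≢0}} (<-≤-trans below (≤-trans 2^m≤t (≤-trans (m≤n+m t t) (n≤1+n (t + t))))) ⟩
    suc (t + t) * (4 ^ t * 4 ^ t) ≡⟨ cong (λ e → suc e * (4 ^ t * 4 ^ t)) (twice t) ⟩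
    s * (4 ^ t * 4 ^ t)             ≡⟨ *-comm s (4 ^ t * 4 ^ t) ⟩
    4 ^ t * 4 ^ t * s               ∎))
    where
    c = central t
    x = a * (m + 3) * c
    s = suc (2 * t)
    16^t≢0 : NonZero (4 ^ t * 4 ^ t)
    16^t≢0 = m*n≢0 (4 ^ t) (4 ^ t) {{m^n≢0 4 t}} {{m^n≢0 4 t}}
    regroup : ∀ a b c s → a * b * c * (a * b * c) * s ≡ a * a * (b * b) * (c * c * s)
    regroup = solve-∀
    twice : ∀ t → t + t ≡ 2 * t
    twice = solve-∀

module ExponentialGrowth where

  open import Data.Nat
  open import Data.Nat.Properties
  open import Data.Product using (∃-syntax; _×_; _,_)
  open import Data.Unit using (tt)
  open import Relation.Binary.PropositionalEquality
  open import Relation.Nullary using (yes; no)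
  open import Relation.Nullary.Decidable using (toWitness)
  open import Data.Nat.Tactic.RingSolver
  open ≤-Reasoning

  log₂-bracket : ∀ n → ∃[ m ] (2 ^ m ≤ suc n × suc n < 2 ^ suc m)
  log₂-bracket zero = 0 , ≤-refl , s≤s (s≤s z≤n)
  log₂-bracket (suc n) with log₂-bracket n
  ... | m , lo , hi with suc (suc n) <? 2 ^ suc m
  ...   | yes below = m , m≤n⇒m≤1+n lo , below
  ...   | no ¬below = suc m , ≤-reflexive (sym reached) , doubled
    where
    reached : suc (suc n) ≡ 2 ^ suc m
    reached = ≤-antisym hi (≮⇒≥ ¬below)
    doubled : suc (suc n) < 2 ^ suc (suc m)
    doubled = begin-strict
      suc (suc n)           ≡⟨ reached ⟩
      2 ^ suc m             <⟨ m<m+n (2 ^ suc m) (m^n>0 2 (suc m)) ⟩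
      2 ^ suc m + 2 ^ suc m ≡⟨ cong (2 ^ suc m +_) (+-identityʳ (2 ^ suc m)) ⟨
      2 ^ suc (suc m)       ∎

  private
    square-<-2^-base : ∀ b → b * ((2 * b + 8 + 3) * (2 * b + 8 + 3)) < 2 ^ (2 * b + 8)
    square-<-2^-base zero          = s≤s z≤n
    square-<-2^-base (suc zero)    = toWitness {a? = 169 <? 1024} tt
    square-<-2^-base (suc (suc c)) = begin-strict
      suc (suc c) * ((2 * suc (suc c) + 8 + 3) * (2 * suc (suc c) + 8 + 3))
        ≤⟨ m≤m+n _ (12 * c * c * c + 156 * c * c + 539 * c + 226) ⟩
      suc (suc c) * ((2 * suc (suc c) + 8 + 3) * (2 * suc (suc c) + 8 + 3)) + (12 * c * c * c + 156 * c * c + 539 * c + 226)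
        ≡⟨ growth c ⟩
      4 * (suc c * ((2 * suc c + 8 + 3) * (2 * suc c + 8 + 3)))
        <⟨ *-monoʳ-< 4 (square-<-2^-base (suc c)) ⟩
      4 * 2 ^ (2 * suc c + 8)
        ≡⟨ exponent c ⟩
      2 ^ (2 * suc (suc c) + 8) ∎
      where
      growth : ∀ c → suc (suc c) * ((2 * suc (suc c) + 8 + 3) * (2 * suc (suc c) + 8 + 3)) + (12 * c * c * c + 156 * c * c + 539 * c + 226)
                   ≡ 4 * (suc c * ((2 * suc c + 8 + 3) * (2 * suc c + 8 + 3)))
      growth = solve-∀
      exponent : ∀ c → 4 * 2 ^ (2 * suc c + 8) ≡ 2 ^ (2 * suc (suc c) + 8)
      exponent c = trans (sym (^-distribˡ-+-* 2 2 (2 * suc c + 8))) (cong (2 ^_) (shift c))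
        where
        shift : ∀ c → 2 + (2 * suc c + 8) ≡ 2 * suc (suc c) + 8
        shift = solve-∀

    square-<-2^-step : ∀ b m → b * ((m + 3) * (m + 3)) < 2 ^ m → b * ((suc m + 3) * (suc m + 3)) < 2 ^ suc m
    square-<-2^-step b m below = begin-strict
      b * ((suc m + 3) * (suc m + 3))
        ≤⟨ m≤m+n _ (b * (m * m + 4 * m + 2)) ⟩
      b * ((suc m + 3) * (suc m + 3)) + b * (m * m + 4 * m + 2)
        ≡⟨ growth b m ⟩
      2 * (b * ((m + 3) * (m + 3)))
        <⟨ *-monoʳ-< 2 below ⟩
      2 ^ suc m ∎
      where
      growth : ∀ b m → b * ((suc m + 3) * (suc m + 3)) + b * (m * m + 4 * m + 2) ≡ 2 * (b * ((m + 3) * (m + 3)))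
      growth = solve-∀

    square-<-2^′ : ∀ b {m} → 2 * b + 8 ≤′ m → b * ((m + 3) * (m + 3)) < 2 ^ m
    square-<-2^′ b ≤′-refl        = square-<-2^-base b
    square-<-2^′ b (≤′-step {m} M≤′m) = square-<-2^-step b m (square-<-2^′ b M≤′m)

  square-<-2^ : ∀ b m → 2 * b + 8 ≤ m → b * ((m + 3) * (m + 3)) < 2 ^ m
  square-<-2^ b m M≤m = square-<-2^′ b (≤⇒≤′ M≤m)

open CentralBinomial using (central; central-suc; *-central<4^)
open ExponentialGrowth using (log₂-bracket; square-<-2^)

open import Data.Nat as ℕ using (ℕ; zero; suc; NonZero)
import Data.Nat.Properties as ℕP
import Data.Nat.Tactic.RingSolver as ℕSolver
open import Data.Integer as ℤ using (+_)
import Data.Integer.Properties as ℤP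
open import Data.Rational hiding (NonZero)
open import Data.Rational.Properties
import Data.Rational.Unnormalised as ℚᵘ
import Data.Rational.Unnormalised.Properties as ℚᵘP
open import Data.List using (_∷_; [])
open import Data.Maybe using (Maybe; just; nothing)
open import Data.Product using (∃-syntax; _,_)
open import Level using (0ℓ)
open import Relation.Binary.PropositionalEquality
open import Relation.Nullary using (yes; no)
open import Tactic.RingSolver using (solve-∀)
import Tactic.RingSolver.Core.AlmostCommutativeRing as ACR

ι : ℕ → ℚ
ι n = + n / 1

private
  pos-cross : ∀ a b c d → a ℕ.* d ≡ c ℕ.* b → + a ℤ.* + d ≡ + c ℤ.* + b
  pos-cross a b c d eq = trans (sym (ℤP.pos-* a d)) (trans (cong +_ eq) (ℤP.pos-* c b))

  toℚᵘ-/ : ∀ a b .{{_ : NonZero b}} → toℚᵘ (+ a / b) ℚᵘ.≃ ℚᵘ.mkℚᵘ (+ a) (ℕ.pred b)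
  toℚᵘ-/ a (suc b) = toℚᵘ-fromℚᵘ (ℚᵘ.mkℚᵘ (+ a) b)

/-≡-cross : ∀ a b c d .{{_ : NonZero b}} .{{_ : NonZero d}} →
            a ℕ.* d ≡ c ℕ.* b → + a / b ≡ + c / d
/-≡-cross a (suc b) c (suc d) eq = fromℚᵘ-cong {ℚᵘ.mkℚᵘ (+ a) b} {ℚᵘ.mkℚᵘ (+ c) d} (ℚᵘ.*≡* (pos-cross a (suc b) c (suc d) eq))

/-≤-cross : ∀ a b c d .{{_ : NonZero b}} .{{_ : NonZero d}} →
            a ℕ.* d ℕ.≤ c ℕ.* b → + a / b ≤ + c / d
/-≤-cross a (suc b) c (suc d) le = toℚᵘ-cancel-≤
  (ℚᵘP.≤-respˡ-≃ (ℚᵘP.≃-sym (toℚᵘ-/ a (suc b))) (ℚᵘP.≤-respʳ-≃ (ℚᵘP.≃-sym (toℚᵘ-/ c (suc d)))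
    (ℚᵘ.*≤* (subst₂ ℤ._≤_ (ℤP.pos-* a (suc d)) (ℤP.pos-* c (suc b)) (ℤ.+≤+ le)))))

/-<-cross : ∀ a b c d .{{_ : NonZero b}} .{{_ : NonZero d}} →
            a ℕ.* d ℕ.< c ℕ.* b → + a / b < + c / d
/-<-cross a (suc b) c (suc d) lt = toℚᵘ-cancel-<
  (ℚᵘP.<-respˡ-≃ (ℚᵘP.≃-sym (toℚᵘ-/ a (suc b))) (ℚᵘP.<-respʳ-≃ (ℚᵘP.≃-sym (toℚᵘ-/ c (suc d)))
    (ℚᵘ.*<* (subst₂ ℤ._<_ (ℤP.pos-* a (suc d)) (ℤP.pos-* c (suc b)) (ℤ.+<+ lt)))))

/-+ : ∀ a b c d .{{_ : NonZero b}} .{{_ : NonZero d}} →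
      + a / b + + c / d ≡ (+ (a ℕ.* d ℕ.+ c ℕ.* b) / (b ℕ.* d)) {{ℕP.m*n≢0 b d}}
/-+ a b@(suc _) c d@(suc _) = toℚᵘ-injective (ℚᵘP.≃-trans (toℚᵘ-homo-+ (+ a / b) (+ c / d))
  (ℚᵘP.≃-trans (ℚᵘP.+-cong (toℚᵘ-/ a b) (toℚᵘ-/ c d))
    (ℚᵘP.≃-sym (ℚᵘP.≃-trans (toℚᵘ-/ (a ℕ.* d ℕ.+ c ℕ.* b) (b ℕ.* d)) (ℚᵘ.*≡* eq)))))
  where
  eq : + (a ℕ.* d ℕ.+ c ℕ.* b) ℤ.* + (b ℕ.* d) ≡ (+ a ℤ.* + d ℤ.+ + c ℤ.* + b) ℤ.* + (b ℕ.* d)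
  eq = cong (ℤ._* + (b ℕ.* d))
         (trans (ℤP.pos-+ (a ℕ.* d) (c ℕ.* b)) (cong₂ ℤ._+_ (ℤP.pos-* a d) (ℤP.pos-* c b)))

/-* : ∀ a b c d .{{_ : NonZero b}} .{{_ : NonZero d}} →
      + a / b * (+ c / d) ≡ (+ (a ℕ.* c) / (b ℕ.* d)) {{ℕP.m*n≢0 b d}}
/-* a b@(suc _) c d@(suc _) = toℚᵘ-injective (ℚᵘP.≃-trans (toℚᵘ-homo-* (+ a / b) (+ c / d))
  (ℚᵘP.≃-trans (ℚᵘP.*-cong (toℚᵘ-/ a b) (toℚᵘ-/ c d))
    (ℚᵘP.≃-sym (ℚᵘP.≃-trans (toℚᵘ-/ (a ℕ.* c) (b ℕ.* d))
      (ℚᵘ.*≡* (cong (ℤ._* + (b ℕ.* d)) (ℤP.pos-* a c)))))))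

0≤/ : ∀ a b .{{_ : NonZero b}} → 0ℚ ≤ + a / b
0≤/ a b = /-≤-cross 0 1 a b ℕ.z≤n

/≤1 : ∀ {a b} .{{_ : NonZero b}} → a ℕ.≤ b → + a / b ≤ 1ℚ
/≤1 {a} {b} le = /-≤-cross a b 1 1 (subst₂ ℕ._≤_ (sym (ℕP.*-identityʳ a)) (sym (ℕP.+-identityʳ b)) le)

0≤* : ∀ {p q} → 0ℚ ≤ p → 0ℚ ≤ q → 0ℚ ≤ p * q
0≤* {p} {q} 0≤p 0≤q = nonNegative⁻¹ (p * q) {{nonNeg*nonNeg⇒nonNeg p {{nonNegative 0≤p}} q {{nonNegative 0≤q}}}}

*-mono-≤-nonNeg : ∀ {p q r s} → 0ℚ ≤ q → 0ℚ ≤ r → p ≤ r → q ≤ s → p * q ≤ r * s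
*-mono-≤-nonNeg {q = q} {r} 0≤q 0≤r p≤r q≤s =
  ≤-trans (*-monoʳ-≤-nonNeg q {{nonNegative 0≤q}} p≤r) (*-monoˡ-≤-nonNeg r {{nonNegative 0≤r}} q≤s)

infixl 6 _⊕_
infixl 7 _⊗_

-- Fraction p a b certifies p = a / b along the syntax of p, so that a rational identity p ≡ q
-- reduces to the polynomial identity a * d ≡ c * b, which the ℕ ring solver proves.
data Fraction : ℚ → ℕ → ℕ → Set where
  _∕_ : ∀ a b {{_ : NonZero b}} → Fraction (+ a / b) a b
  _⊕_ : ∀ {p q a b c d} → Fraction p a b → Fraction q c d → Fraction (p + q) (a ℕ.* d ℕ.+ c ℕ.* b) (b ℕ.* d)
  _⊗_ : ∀ {p q a b c d} → Fraction p a b → Fraction q c d → Fraction (p * q) (a ℕ.* c) (b ℕ.* d)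

denominator≢0 : ∀ {p a b} → Fraction p a b → NonZero b
denominator≢0 (_∕_ a b {{b≢0}}) = b≢0
denominator≢0 (x ⊕ y) = ℕP.m*n≢0 _ _ {{denominator≢0 x}} {{denominator≢0 y}}
denominator≢0 (x ⊗ y) = ℕP.m*n≢0 _ _ {{denominator≢0 x}} {{denominator≢0 y}}

fraction-normal : ∀ {p a b} (x : Fraction p a b) → p ≡ (+ a / b) {{denominator≢0 x}}
fraction-normal (a ∕ b) = refl
fraction-normal (_⊕_ {a = a} {b} {c} {d} x y) = trans (cong₂ _+_ (fraction-normal x) (fraction-normal y))
  (/-+ a b c d {{denominator≢0 x}} {{denominator≢0 y}})
fraction-normal (_⊗_ {a = a} {b} {c} {d} x y) = trans (cong₂ _*_ (fraction-normal x) (fraction-normal y))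
  (/-* a b c d {{denominator≢0 x}} {{denominator≢0 y}})

fraction-≡ : ∀ {p q a b c d} → Fraction p a b → Fraction q c d → a ℕ.* d ≡ c ℕ.* b → p ≡ q
fraction-≡ {a = a} {b} {c} {d} x y eq = trans (fraction-normal x)
  (trans (/-≡-cross a b c d {{denominator≢0 x}} {{denominator≢0 y}} eq) (sym (fraction-normal y)))

fraction-≤ : ∀ {p q a b c d} → Fraction p a b → Fraction q c d → ∀ r → a ℕ.* d ℕ.+ r ≡ c ℕ.* b → p ≤ q
fraction-≤ {a = a} {b} {c} {d} x y r eq = subst₂ _≤_ (sym (fraction-normal x)) (sym (fraction-normal y))
  (/-≤-cross a b c d {{denominator≢0 x}} {{denominator≢0 y}} (ℕP.≤-trans (ℕP.m≤m+n _ r) (ℕP.≤-reflexive eq)))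

ι*ι*/ : ∀ a b c q {{_ : NonZero q}} → ι a * (ι b * (+ c / q)) ≡ + (a ℕ.* b ℕ.* c) / q
ι*ι*/ a b c q = fraction-≡ (a ∕ 1 ⊗ (b ∕ 1 ⊗ c ∕ q)) ((a ℕ.* b ℕ.* c) ∕ q)
                     (ℕSolver.solve (a ∷ b ∷ c ∷ q ∷ []))

ℚ-ring : ACR.AlmostCommutativeRing 0ℓ 0ℓ
ℚ-ring = ACR.fromCommutativeRing +-*-commutativeRing isZero
  where
  isZero : ∀ x → Maybe (0ℚ ≡ x)
  isZero x with 0ℚ ≟ x
  ... | yes 0≡x = just 0≡x
  ... | no _    = nothing

sumBelow : (ℕ → ℚ) → ℕ → ℚ
sumBelow f zero    = 0ℚ
sumBelow f (suc n) = sumBelow f n + f n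

syntax sumBelow (λ m → e) n = ∑[ m < n ] e

sumBelow-telescope : ∀ (f g d : ℕ → ℚ) → (∀ m → f m + d (suc m) ≡ g m + d m) →
                     ∀ n → sumBelow f n + d n ≡ sumBelow g n + d 0
sumBelow-telescope f g d step zero    = refl
sumBelow-telescope f g d step (suc n) = begin
  sumBelow f n + f n + d (suc n)   ≡⟨ regroup (sumBelow f n) (f n) (d (suc n)) ⟩
  sumBelow f n + (f n + d (suc n)) ≡⟨ cong (λ x → sumBelow f n + x) (step n) ⟩
  sumBelow f n + (g n + d n)       ≡⟨ swap (sumBelow f n) (g n) (d n) ⟩
  sumBelow f n + d n + g n         ≡⟨ cong (_+ g n) (sumBelow-telescope f g d step n) ⟩
  sumBelow g n + d 0 + g n         ≡⟨ swap′ (sumBelow g n) (d 0) (g n) ⟩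
  sumBelow g n + g n + d 0         ∎
  where
  open ≡-Reasoning
  regroup : ∀ a b c → a + b + c ≡ a + (b + c)
  regroup = solve-∀ ℚ-ring
  swap : ∀ a b c → a + (b + c) ≡ a + c + b
  swap = solve-∀ ℚ-ring
  swap′ : ∀ a b c → a + b + c ≡ a + c + b
  swap′ = solve-∀ ℚ-ring

*-distribˡ-sumBelow : ∀ c (f : ℕ → ℚ) n → c * sumBelow f n ≡ ∑[ m < n ] (c * f m)
*-distribˡ-sumBelow c f zero    = *-zeroʳ c
*-distribˡ-sumBelow c f (suc n) =
  trans (*-distribˡ-+ c (sumBelow f n) (f n)) (cong (_+ c * f n) (*-distribˡ-sumBelow c f n))

sumBelow-+ : ∀ (f g : ℕ → ℚ) n → ∑[ m < n ] (f m + g m) ≡ sumBelow f n + sumBelow g n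
sumBelow-+ f g zero    = refl
sumBelow-+ f g (suc n) =
  trans (cong (_+ (f n + g n)) (sumBelow-+ f g n)) (interchange (sumBelow f n) (sumBelow g n) (f n) (g n))
  where
  interchange : ∀ a b c d → a + b + (c + d) ≡ a + c + (b + d)
  interchange = solve-∀ ℚ-ring

partialSum≡sumBelow : ∀ k n → partialSum k n ≡ sumBelow (term k) n
partialSum≡sumBelow k zero    = refl
partialSum≡sumBelow k (suc n) = cong (_+ term k n) (partialSum≡sumBelow k n)

Vanishing : (ℕ → ℚ) → Set
Vanishing f = ∀ ε → 0ℚ < ε → ∃[ N ] (∀ n → N ℕ.≤ n → f n < ε)

SumsTo-dominated : ∀ S L {f} → (∀ n → ∣ S n - L ∣ ≤ f n) → Vanishing f → SumsTo S L
SumsTo-dominated S L dominated vanishing ε 0<ε with vanishing ε 0<ε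
... | N , small = N , λ n N≤n → ≤-<-trans (dominated n) (small n N≤n)

ι-suc : ∀ n → ι (suc n) ≡ ι n + 1ℚ
ι-suc n = fraction-≡ (suc n ∕ 1) (n ∕ 1 ⊕ 1 ∕ 1) (ℕSolver.solve (n ∷ []))

cbw-suc : ∀ n → cbw (suc n) ≡ cbw n * (+ suc (2 ℕ.* n) / (2 ℕ.* suc n))
cbw-suc n = sym (trans
  (/-* (central n) (4 ℕ.^ n) (suc (2 ℕ.* n)) (2 ℕ.* suc n) {{ℕP.m^n≢0 4 n}})
  (/-≡-cross (central n ℕ.* suc (2 ℕ.* n)) (4 ℕ.^ n ℕ.* (2 ℕ.* suc n)) (central (suc n)) (4 ℕ.^ suc n)
    {{ℕP.m*n≢0 (4 ℕ.^ n) _ {{ℕP.m^n≢0 4 n}}}} {{ℕP.m^n≢0 4 (suc n)}} cross))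
  where
  open ≡-Reasoning
  c = central n
  c′ = central (suc n)
  p = 4 ℕ.^ n
  cross : c ℕ.* suc (2 ℕ.* n) ℕ.* (4 ℕ.* p) ≡ c′ ℕ.* (p ℕ.* (2 ℕ.* suc n))
  cross = begin
    c ℕ.* suc (2 ℕ.* n) ℕ.* (4 ℕ.* p)         ≡⟨ regroup c p n ⟩
    2 ℕ.* p ℕ.* (2 ℕ.* (suc (2 ℕ.* n) ℕ.* c)) ≡⟨ cong (2 ℕ.* p ℕ.*_) (central-suc n) ⟨
    2 ℕ.* p ℕ.* (suc n ℕ.* c′)                 ≡⟨ regroup′ c′ p n ⟩
    c′ ℕ.* (p ℕ.* (2 ℕ.* suc n))               ∎
    where
    regroup : ∀ c p n → c ℕ.* suc (2 ℕ.* n) ℕ.* (4 ℕ.* p) ≡ 2 ℕ.* p ℕ.* (2 ℕ.* (suc (2 ℕ.* n) ℕ.* c))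
    regroup = ℕSolver.solve-∀
    regroup′ : ∀ c p n → 2 ℕ.* p ℕ.* (suc n ℕ.* c) ≡ c ℕ.* (p ℕ.* (2 ℕ.* suc n))
    regroup′ = ℕSolver.solve-∀

-- Summands are indexed by m, standing for i = m + 1 in the series.
weight : ℕ → ℚ
weight k = ι k * cbw k

auxTerm : ℕ → ℕ → ℚ
auxTerm k m = + 1 / (suc m ℕ.+ k) * cbw (suc m)

boundary : ℕ → ℕ → ℚ
boundary k m = cbw (suc m) * (+ suc m / (suc m ℕ.+ k)) * cbw k

-- Both sides equal c_k c_i, since (k+1) c_(k+1) = (k + ½) c_k and (i+1) c_(i+1) = (i + ½) c_i.
auxTerm-telescopes : ∀ k m → weight (suc k) * auxTerm (suc k) m + boundary k (suc m)
                           ≡ weight k * auxTerm k m + boundary k m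
auxTerm-telescopes k m = begin
  ι (suc k) * cbw (suc k) * (r₁ * b) + cbw (suc (suc m)) * s₁ * a
    ≡⟨ cong₂ (λ x y → ι (suc k) * x * (r₁ * b) + y * s₁ * a) (cbw-suc k) (cbw-suc (suc m)) ⟩
  ι (suc k) * (a * p) * (r₁ * b) + b * p′ * s₁ * a
    ≡⟨ factor (ι (suc k)) a p r₁ b p′ s₁ ⟩
  a * b * (ι (suc k) * p * r₁ + p′ * s₁)
    ≡⟨ cong (a * b *_) (fraction-≡ (suc k ∕ 1 ⊗ suc (2 ℕ.* k) ∕ (2 ℕ.* suc k) ⊗ 1 ∕ (suc m ℕ.+ suc k)
                              ⊕ suc (2 ℕ.* suc m) ∕ (2 ℕ.* suc (suc m)) ⊗ suc (suc m) ∕ (suc (suc m) ℕ.+ k))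
                             (k ∕ 1 ⊗ 1 ∕ (suc m ℕ.+ k) ⊕ suc m ∕ (suc m ℕ.+ k))
                             (ℕSolver.solve (k ∷ m ∷ []))) ⟩
  a * b * (ι k * r₀ + s₀)
    ≡⟨ unfactor (ι k) a r₀ b s₀ ⟩
  ι k * a * (r₀ * b) + b * s₀ * a ∎
  where
  open ≡-Reasoning
  a = cbw k
  b = cbw (suc m)
  p = + suc (2 ℕ.* k) / (2 ℕ.* suc k)
  p′ = + suc (2 ℕ.* suc m) / (2 ℕ.* suc (suc m))
  r₀ = + 1 / (suc m ℕ.+ k)
  r₁ = + 1 / (suc m ℕ.+ suc k)
  s₀ = + suc m / (suc m ℕ.+ k)
  s₁ = + suc (suc m) / (suc (suc m) ℕ.+ k)
  factor : ∀ i a p r b p′ s → i * (a * p) * (r * b) + b * p′ * s * a ≡ a * b * (i * p * r + p′ * s)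
  factor = solve-∀ ℚ-ring
  unfactor : ∀ i a r b s → a * b * (i * r + s) ≡ i * a * (r * b) + b * s * a
  unfactor = solve-∀ ℚ-ring

boundary-suc : ∀ k m → boundary k (suc m) * (+ 1 / suc (2 ℕ.* suc m))
                     ≡ weight (suc k) * auxTerm (suc k) m * (+ 1 / suc (2 ℕ.* k))
boundary-suc k m = begin
  cbw (suc (suc m)) * s₁ * a * e
    ≡⟨ cong (λ y → y * s₁ * a * e) (cbw-suc (suc m)) ⟩
  b * p′ * s₁ * a * e
    ≡⟨ factor a b p′ s₁ e ⟩
  a * b * (p′ * s₁ * e)
    ≡⟨ cong (a * b *_) (fraction-≡ (suc (2 ℕ.* suc m) ∕ (2 ℕ.* suc (suc m)) ⊗ suc (suc m) ∕ (suc (suc m) ℕ.+ k) ⊗ 1 ∕ suc (2 ℕ.* suc m))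
                             (suc k ∕ 1 ⊗ suc (2 ℕ.* k) ∕ (2 ℕ.* suc k) ⊗ 1 ∕ (suc m ℕ.+ suc k) ⊗ 1 ∕ suc (2 ℕ.* k))
                             (ℕSolver.solve (k ∷ m ∷ []))) ⟩
  a * b * (ι (suc k) * p * r₁ * g)
    ≡⟨ unfactor (ι (suc k)) a p r₁ b g ⟩
  ι (suc k) * (a * p) * (r₁ * b) * g
    ≡⟨ cong (λ x → ι (suc k) * x * (r₁ * b) * g) (cbw-suc k) ⟨
  ι (suc k) * cbw (suc k) * (r₁ * b) * g ∎
  where
  open ≡-Reasoning
  a = cbw k
  b = cbw (suc m)
  p = + suc (2 ℕ.* k) / (2 ℕ.* suc k)
  p′ = + suc (2 ℕ.* suc m) / (2 ℕ.* suc (suc m))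
  r₁ = + 1 / (suc m ℕ.+ suc k)
  s₁ = + suc (suc m) / (suc (suc m) ℕ.+ k)
  e = + 1 / suc (2 ℕ.* suc m)
  g = + 1 / suc (2 ℕ.* k)
  factor : ∀ a b p′ s e → b * p′ * s * a * e ≡ a * b * (p′ * s * e)
  factor = solve-∀ ℚ-ring
  unfactor : ∀ i a p r b g → a * b * (i * p * r * g) ≡ i * (a * p) * (r * b) * g
  unfactor = solve-∀ ℚ-ring

boundary-zero : ∀ k → boundary k 0 ≡ cbw (suc k) * (+ 1 / suc (2 ℕ.* k))
-- cbw 1 computes to 1/2
boundary-zero k = begin
  + 1 / 2 * (+ 1 / suc k) * a
    ≡⟨ cong (_* a) (fraction-≡ (1 ∕ 2 ⊗ 1 ∕ suc k) (suc (2 ℕ.* k) ∕ (2 ℕ.* suc k) ⊗ 1 ∕ suc (2 ℕ.* k))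
                       (ℕSolver.solve (k ∷ []))) ⟩
  p * g * a
    ≡⟨ regroup a p g ⟩
  a * p * g
    ≡⟨ cong (_* g) (cbw-suc k) ⟨
  cbw (suc k) * g ∎
  where
  open ≡-Reasoning
  a = cbw k
  p = + suc (2 ℕ.* k) / (2 ℕ.* suc k)
  g = + 1 / suc (2 ℕ.* k)
  regroup : ∀ a p g → p * g * a ≡ a * p * g
  regroup = solve-∀ ℚ-ring

boundary-zero+cbw-suc : ∀ k → boundary k 0 + cbw (suc k) ≡ cbw k
boundary-zero+cbw-suc k = begin
  boundary k 0 + cbw (suc k)
    ≡⟨ cong (_+ cbw (suc k)) (boundary-zero k) ⟩
  cbw (suc k) * g + cbw (suc k)
    ≡⟨ cong (λ c → c * g + c) (cbw-suc k) ⟩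
  a * p * g + a * p
    ≡⟨ factor a p g ⟩
  a * (p * g + p)
    ≡⟨ cong (a *_) (fraction-≡ (suc (2 ℕ.* k) ∕ (2 ℕ.* suc k) ⊗ 1 ∕ suc (2 ℕ.* k) ⊕ suc (2 ℕ.* k) ∕ (2 ℕ.* suc k)) (1 ∕ 1)
                        (ℕSolver.solve (k ∷ []))) ⟩
  a * 1ℚ
    ≡⟨ *-identityʳ a ⟩
  a ∎
  where
  open ≡-Reasoning
  a = cbw k
  p = + suc (2 ℕ.* k) / (2 ℕ.* suc k)
  g = + 1 / suc (2 ℕ.* k)
  factor : ∀ a p g → a * p * g + a * p ≡ a * (p * g + p)
  factor = solve-∀ ℚ-ring

-- The increment 1/(2i+1) of h turns the boundary term back into an auxiliary term (boundary-suc).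
term-telescopes : ∀ k m → weight (suc k) * term (suc k) m + oddH (suc (suc m)) * boundary k (suc m)
                        ≡ weight k * term k m + + 1 / suc (2 ℕ.* k) * (weight (suc k) * auxTerm (suc k) m)
                          + oddH (suc m) * boundary k m
term-telescopes k m = begin
  w′ * (h * r₁ * b) + (h + e) * β₁
    ≡⟨ distribute w′ h r₁ b e β₁ ⟩
  h * (w′ * (r₁ * b) + β₁) + β₁ * e
    ≡⟨ cong₂ (λ x y → h * x + y) (auxTerm-telescopes k m) (boundary-suc k m) ⟩
  h * (w * (r₀ * b) + β₀) + w′ * (r₁ * b) * g
    ≡⟨ collect w h r₀ b β₀ w′ r₁ g ⟩
  w * (h * r₀ * b) + g * (w′ * (r₁ * b)) + h * β₀ ∎
  where
  open ≡-Reasoning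
  g = + 1 / suc (2 ℕ.* k)
  w = weight k
  w′ = weight (suc k)
  h = oddH (suc m)
  e = + 1 / suc (2 ℕ.* suc m)
  b = cbw (suc m)
  r₀ = + 1 / (suc m ℕ.+ k)
  r₁ = + 1 / (suc m ℕ.+ suc k)
  β₀ = boundary k m
  β₁ = boundary k (suc m)
  distribute : ∀ w′ h r b e β → w′ * (h * r * b) + (h + e) * β ≡ h * (w′ * (r * b) + β) + β * e
  distribute = solve-∀ ℚ-ring
  collect : ∀ w h r₀ b β₀ w′ r₁ g → h * (w * (r₀ * b) + β₀) + w′ * (r₁ * b) * g
                                  ≡ w * (h * r₀ * b) + g * (w′ * (r₁ * b)) + h * β₀
  collect = solve-∀ ℚ-ring

auxSum : ℕ → ℕ → ℚ
auxSum k = sumBelow (auxTerm k)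

auxRemainder : ℕ → ℕ → ℚ
auxRemainder k n = ∑[ j < k ] boundary j n

remainder : ℕ → ℕ → ℚ
remainder k n = ∑[ j < k ] (oddH (suc n) * boundary j n + auxRemainder (suc j) n * (+ 1 / suc (2 ℕ.* j)))

auxSum-shift : ∀ k n → weight (suc k) * auxSum (suc k) n + boundary k n ≡ weight k * auxSum k n + boundary k 0
auxSum-shift k n = begin
  weight (suc k) * auxSum (suc k) n + boundary k n
    ≡⟨ cong (_+ boundary k n) (*-distribˡ-sumBelow (weight (suc k)) (auxTerm (suc k)) n) ⟩
  ∑[ m < n ] (weight (suc k) * auxTerm (suc k) m) + boundary k n
    ≡⟨ sumBelow-telescope _ _ (boundary k) (auxTerm-telescopes k) n ⟩
  ∑[ m < n ] (weight k * auxTerm k m) + boundary k 0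
    ≡⟨ cong (_+ boundary k 0) (*-distribˡ-sumBelow (weight k) (auxTerm k) n) ⟨
  weight k * auxSum k n + boundary k 0 ∎
  where open ≡-Reasoning

partialSum-shift : ∀ k n → weight (suc k) * partialSum (suc k) n + oddH (suc n) * boundary k n
                       ≡ weight k * partialSum k n + boundary k 0
                         + + 1 / suc (2 ℕ.* k) * (weight (suc k) * auxSum (suc k) n)
partialSum-shift k n = begin
  weight (suc k) * partialSum (suc k) n + oddH (suc n) * boundary k n
    ≡⟨ cong (λ x → x + oddH (suc n) * boundary k n) (scaled (suc k)) ⟩
  ∑[ m < n ] (weight (suc k) * term (suc k) m) + oddH (suc n) * boundary k n
    ≡⟨ sumBelow-telescope _ _ (λ m → oddH (suc m) * boundary k m) (term-telescopes k) n ⟩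
  ∑[ m < n ] (weight k * term k m + g * (weight (suc k) * auxTerm (suc k) m)) + 1ℚ * boundary k 0
    ≡⟨ cong₂ _+_ (sumBelow-+ _ _ n) (*-identityˡ (boundary k 0)) ⟩
  ∑[ m < n ] (weight k * term k m) + ∑[ m < n ] (g * (weight (suc k) * auxTerm (suc k) m)) + boundary k 0
    ≡⟨ cong₂ (λ x y → x + y + boundary k 0) (sym (scaled k))
             (trans (sym (*-distribˡ-sumBelow g _ n))
                    (cong (g *_) (sym (*-distribˡ-sumBelow (weight (suc k)) (auxTerm (suc k)) n)))) ⟩
  weight k * partialSum k n + g * (weight (suc k) * auxSum (suc k) n) + boundary k 0
    ≡⟨ swap (weight k * partialSum k n) _ (boundary k 0) ⟩
  weight k * partialSum k n + boundary k 0 + g * (weight (suc k) * auxSum (suc k) n) ∎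
  where
  open ≡-Reasoning
  g = + 1 / suc (2 ℕ.* k)
  scaled : ∀ k → weight k * partialSum k n ≡ ∑[ m < n ] (weight k * term k m)
  scaled k = trans (cong (weight k *_) (partialSum≡sumBelow k n)) (*-distribˡ-sumBelow (weight k) (term k) n)
  swap : ∀ a b c → a + b + c ≡ a + c + b
  swap = solve-∀ ℚ-ring

auxSum-closed : ∀ k n → weight k * auxSum k n + auxRemainder k n ≡ 1ℚ - cbw k
auxSum-closed zero    n = vanish (auxSum 0 n)
  where
  -- weight 0 and cbw 0 compute to 0ℚ * 1ℚ and 1ℚ
  vanish : ∀ x → 0ℚ * 1ℚ * x + 0ℚ ≡ 1ℚ - 1ℚ
  vanish = solve-∀ ℚ-ring
auxSum-closed (suc k) n = begin
  W′ + (E + boundary k n)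
    ≡⟨ regroup W′ E (boundary k n) ⟩
  (W′ + boundary k n) + E
    ≡⟨ cong (_+ E) (auxSum-shift k n) ⟩
  (W + boundary k 0) + E
    ≡⟨ regroup′ W (boundary k 0) E ⟩
  (W + E) + boundary k 0
    ≡⟨ cong (_+ boundary k 0) (auxSum-closed k n) ⟩
  1ℚ - cbw k + boundary k 0
    ≡⟨ cong (λ c → 1ℚ - c + boundary k 0) (boundary-zero+cbw-suc k) ⟨
  1ℚ - (boundary k 0 + cbw (suc k)) + boundary k 0
    ≡⟨ cancel (boundary k 0) (cbw (suc k)) ⟩
  1ℚ - cbw (suc k) ∎
  where
  open ≡-Reasoning
  W′ = weight (suc k) * auxSum (suc k) n
  W = weight k * auxSum k n
  E = auxRemainder k n
  regroup : ∀ a b c → a + (b + c) ≡ (a + c) + b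
  regroup = solve-∀ ℚ-ring
  regroup′ : ∀ a b c → (a + b) + c ≡ (a + c) + b
  regroup′ = solve-∀ ℚ-ring
  cancel : ∀ β c → 1ℚ - (β + c) + β ≡ 1ℚ - c
  cancel = solve-∀ ℚ-ring

partialSum-closed : ∀ k n → weight k * partialSum k n + remainder k n ≡ oddH k
partialSum-closed zero    n = vanish (partialSum 0 n)
  where
  vanish : ∀ x → 0ℚ * 1ℚ * x + 0ℚ ≡ 0ℚ
  vanish = solve-∀ ℚ-ring
partialSum-closed (suc k) n = begin
  S′ + (E + (h * boundary k n + E′ * g))
    ≡⟨ regroup S′ E (h * boundary k n) (E′ * g) ⟩
  (S′ + h * boundary k n) + E + E′ * g
    ≡⟨ cong (λ x → x + E + E′ * g) (partialSum-shift k n) ⟩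
  (S + boundary k 0 + g * W′) + E + E′ * g
    ≡⟨ regroup′ S (boundary k 0) g W′ E E′ ⟩
  (S + E) + boundary k 0 + g * (W′ + E′)
    ≡⟨ cong₂ (λ x y → x + boundary k 0 + g * y) (partialSum-closed k n) (auxSum-closed (suc k) n) ⟩
  oddH k + boundary k 0 + g * (1ℚ - cbw (suc k))
    ≡⟨ cong (λ x → oddH k + x + g * (1ℚ - cbw (suc k))) (boundary-zero k) ⟩
  oddH k + cbw (suc k) * g + g * (1ℚ - cbw (suc k))
    ≡⟨ cancel (oddH k) (cbw (suc k)) g ⟩
  oddH k + g ∎
  where
  open ≡-Reasoning
  S′ = weight (suc k) * partialSum (suc k) n
  S = weight k * partialSum k n
  W′ = weight (suc k) * auxSum (suc k) n
  E = remainder k n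
  E′ = auxRemainder (suc k) n
  h = oddH (suc n)
  g = + 1 / suc (2 ℕ.* k)
  regroup : ∀ a b c d → a + (b + (c + d)) ≡ (a + c) + b + d
  regroup = solve-∀ ℚ-ring
  regroup′ : ∀ s β g w e e′ → (s + β + g * w) + e + e′ * g ≡ (s + e) + β + g * (w + e′)
  regroup′ = solve-∀ ℚ-ring
  cancel : ∀ h c g → h + c * g + g * (1ℚ - c) ≡ h + g
  cancel = solve-∀ ℚ-ring

cbw-nonNeg : ∀ n → 0ℚ ≤ cbw n
cbw-nonNeg n = 0≤/ (central n) (4 ℕ.^ n) {{ℕP.m^n≢0 4 n}}

cbw-≤1 : ∀ n → cbw n ≤ 1ℚ
cbw-≤1 zero    = ≤-refl
cbw-≤1 (suc n) = subst (_≤ 1ℚ) (sym (cbw-suc n))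
  (*-mono-≤-nonNeg (0≤/ (suc (2 ℕ.* n)) (2 ℕ.* suc n)) (0≤/ 1 1) (cbw-≤1 n)
    (fraction-≤ (suc (2 ℕ.* n) ∕ (2 ℕ.* suc n)) (1 ∕ 1) 1 (ℕSolver.solve (n ∷ []))))

oddH-nonNeg : ∀ n → 0ℚ ≤ oddH n
oddH-nonNeg zero    = ≤-refl
oddH-nonNeg (suc n) = +-mono-≤ (oddH-nonNeg n) (0≤/ 1 (suc (2 ℕ.* n)))

oddH-≤-suc : ∀ n → oddH n ≤ oddH (suc n)
oddH-≤-suc n = ≤-trans (≤-reflexive (sym (+-identityʳ (oddH n)))) (+-monoʳ-≤ (oddH n) (0≤/ 1 (suc (2 ℕ.* n))))

oddH-mono-≤ : ∀ {m n} → m ℕ.≤ n → oddH m ≤ oddH n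
oddH-mono-≤ m≤n = mono (ℕP.≤⇒≤′ m≤n)
  where
  mono : ∀ {m n} → m ℕ.≤′ n → oddH m ≤ oddH n
  mono ℕ.≤′-refl               = ≤-refl
  mono (ℕ.≤′-step {n} m≤′n) = ≤-trans (mono m≤′n) (oddH-≤-suc n)

1≤oddH-suc : ∀ n → 1ℚ ≤ oddH (suc n)
1≤oddH-suc n = oddH-mono-≤ {1} {suc n} (ℕ.s≤s ℕ.z≤n)

oddH-+-≤ : ∀ a b → oddH (b ℕ.+ a) ≤ oddH a + + b / suc (2 ℕ.* a)
oddH-+-≤ a zero    = ≤-reflexive (sym (trans (cong (λ x → oddH a + x) (0/n≡0 (suc (2 ℕ.* a)))) (+-identityʳ (oddH a))))
oddH-+-≤ a (suc b) = ≤-trans (+-mono-≤ (oddH-+-≤ a b) later-term-≤)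
  (≤-reflexive (trans (+-assoc (oddH a) _ _) (cong (λ x → oddH a + x) merge)))
  where
  merge : + b / suc (2 ℕ.* a) + + 1 / suc (2 ℕ.* a) ≡ + suc b / suc (2 ℕ.* a)
  merge = fraction-≡ (b ∕ suc (2 ℕ.* a) ⊕ 1 ∕ suc (2 ℕ.* a)) (suc b ∕ suc (2 ℕ.* a)) (ℕSolver.solve (a ∷ b ∷ []))
  later-term-≤ : + 1 / suc (2 ℕ.* (b ℕ.+ a)) ≤ + 1 / suc (2 ℕ.* a)
  later-term-≤ = fraction-≤ (1 ∕ suc (2 ℕ.* (b ℕ.+ a))) (1 ∕ suc (2 ℕ.* a)) (2 ℕ.* b) (ℕSolver.solve (a ∷ b ∷ []))

oddH-2^-≤ : ∀ m → oddH (2 ℕ.^ m) ≤ ι (m ℕ.+ 2)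
oddH-2^-≤ zero    = fraction-≤ (1 ∕ 1) (2 ∕ 1) 1 refl
oddH-2^-≤ (suc m) = begin
  oddH (p ℕ.+ (p ℕ.+ 0)) ≡⟨ cong (λ x → oddH (p ℕ.+ x)) (ℕP.+-identityʳ p) ⟩
  oddH (p ℕ.+ p)         ≤⟨ oddH-+-≤ p p ⟩
  oddH p + + p / suc (2 ℕ.* p) ≤⟨ +-mono-≤ (oddH-2^-≤ m) (/≤1 (ℕP.≤-trans (ℕP.m≤n*m p 2) (ℕP.n≤1+n _))) ⟩
  ι (m ℕ.+ 2) + 1ℚ       ≡⟨ ι-suc (m ℕ.+ 2) ⟨
  ι (suc m ℕ.+ 2)        ∎
  where
  open ≤-Reasoning
  p = 2 ℕ.^ m

boundary-nonNeg : ∀ j n → 0ℚ ≤ boundary j n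
boundary-nonNeg j n = 0≤* (0≤* (cbw-nonNeg (suc n)) (0≤/ (suc n) (suc n ℕ.+ j))) (cbw-nonNeg j)

boundary-≤ : ∀ j n → boundary j n ≤ cbw (suc n)
boundary-≤ j n = begin
  c * (+ suc n / (suc n ℕ.+ j)) * cbw j ≤⟨ *-mono-≤-nonNeg (cbw-nonNeg j) (0≤* (cbw-nonNeg (suc n)) (0≤/ 1 1))
                                            (*-monoˡ-≤-nonNeg c {{nonNegative (cbw-nonNeg (suc n))}} (/≤1 (ℕP.m≤m+n (suc n) j)))
                                            (cbw-≤1 j) ⟩
  c * 1ℚ * 1ℚ                            ≡⟨ trans (*-identityʳ (c * 1ℚ)) (*-identityʳ c) ⟩
  c                                      ∎
  where
  open ≤-Reasoning
  c = cbw (suc n)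

auxRemainder-nonNeg : ∀ k n → 0ℚ ≤ auxRemainder k n
auxRemainder-nonNeg zero    n = ≤-refl
auxRemainder-nonNeg (suc k) n = +-mono-≤ (auxRemainder-nonNeg k n) (boundary-nonNeg k n)

auxRemainder-≤ : ∀ k n → auxRemainder k n ≤ ι k * cbw (suc n)
auxRemainder-≤ zero    n = ≤-reflexive (sym (*-zeroˡ (cbw (suc n))))
auxRemainder-≤ (suc k) n = begin
  auxRemainder k n + boundary k n ≤⟨ +-mono-≤ (auxRemainder-≤ k n) (boundary-≤ k n) ⟩
  ι k * c + c                 ≡⟨ collect (ι k) c ⟩
  (ι k + 1ℚ) * c              ≡⟨ cong (_* c) (ι-suc k) ⟨
  ι (suc k) * c               ∎
  where
  open ≤-Reasoning
  c = cbw (suc n)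
  collect : ∀ i c → i * c + c ≡ (i + 1ℚ) * c
  collect = solve-∀ ℚ-ring

remainder-nonNeg : ∀ k n → 0ℚ ≤ remainder k n
remainder-nonNeg zero    n = ≤-refl
remainder-nonNeg (suc k) n = +-mono-≤ (remainder-nonNeg k n)
  (+-mono-≤ (0≤* (oddH-nonNeg (suc n)) (boundary-nonNeg k n)) (0≤* (auxRemainder-nonNeg (suc k) n) (0≤/ 1 (suc (2 ℕ.* k)))))

remainder-≤ : ∀ k n → remainder k n ≤ ι (2 ℕ.* k) * (oddH (suc n) * cbw (suc n))
remainder-≤ zero    n = ≤-reflexive (sym (*-zeroˡ (oddH (suc n) * cbw (suc n))))
remainder-≤ (suc k) n = begin
  remainder k n + (h * boundary k n + auxRemainder (suc k) n * g)
    ≤⟨ +-mono-≤ (remainder-≤ k n) (+-mono-≤ (*-monoˡ-≤-nonNeg h {{nonNegative (oddH-nonNeg (suc n))}} (boundary-≤ k n)) aux-≤) ⟩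
  ι (2 ℕ.* k) * X + (X + X)
    ≡⟨ collect (ι (2 ℕ.* k)) X ⟩
  (ι (2 ℕ.* k) + 1ℚ + 1ℚ) * X
    ≡⟨ cong (_* X) (fraction-≡ ((2 ℕ.* suc k) ∕ 1) ((2 ℕ.* k) ∕ 1 ⊕ 1 ∕ 1 ⊕ 1 ∕ 1) (ℕSolver.solve (k ∷ []))) ⟨
  ι (2 ℕ.* suc k) * X ∎
  where
  open ≤-Reasoning
  h = oddH (suc n)
  c = cbw (suc n)
  X = h * c
  g = + 1 / suc (2 ℕ.* k)
  c≤X : c ≤ X
  c≤X = ≤-trans (≤-reflexive (sym (*-identityˡ c))) (*-monoʳ-≤-nonNeg c {{nonNegative (cbw-nonNeg (suc n))}} (1≤oddH-suc n))
  aux-≤ : auxRemainder (suc k) n * g ≤ X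
  aux-≤ = begin
    auxRemainder (suc k) n * g ≤⟨ *-monoʳ-≤-nonNeg g {{nonNegative (0≤/ 1 (suc (2 ℕ.* k)))}} (auxRemainder-≤ (suc k) n) ⟩
    ι (suc k) * c * g      ≡⟨ swap (ι (suc k)) c g ⟩
    ι (suc k) * g * c      ≤⟨ *-monoʳ-≤-nonNeg c {{nonNegative (cbw-nonNeg (suc n))}}
                               (fraction-≤ (suc k ∕ 1 ⊗ 1 ∕ suc (2 ℕ.* k)) (1 ∕ 1) k (ℕSolver.solve (k ∷ []))) ⟩
    1ℚ * c                 ≡⟨ *-identityˡ c ⟩
    c                      ≤⟨ c≤X ⟩
    X                      ∎
    where
    swap : ∀ i c g → i * c * g ≡ i * g * c
    swap = solve-∀ ℚ-ring
  collect : ∀ i x → i * x + (x + x) ≡ (i + 1ℚ + 1ℚ) * x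
  collect = solve-∀ ℚ-ring

partialSum-deviation-≤ : ∀ k n → ∣ cbw (suc k) * partialSum (suc k) n - oddH (suc k) * (+ 1 / suc k) ∣
                             ≤ ι 2 * (oddH (suc n) * cbw (suc n))
partialSum-deviation-≤ k n = begin
  ∣ c * S - oddH (suc k) * r ∣
    ≡⟨ cong (λ h → ∣ c * S - h * r ∣) (partialSum-closed (suc k) n) ⟨
  ∣ c * S - (ι (suc k) * c * S + E) * r ∣
    ≡⟨ cong ∣_∣ (rearrange c S (ι (suc k)) E r) ⟩
  ∣ c * S * (1ℚ - ι (suc k) * r) - E * r ∣
    ≡⟨ cong (λ x → ∣ c * S * (1ℚ - x) - E * r ∣) (fraction-≡ (suc k ∕ 1 ⊗ 1 ∕ suc k) (1 ∕ 1) (ℕSolver.solve (k ∷ []))) ⟩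
  ∣ c * S * (1ℚ - 1ℚ) - E * r ∣
    ≡⟨ cong ∣_∣ (cancel c S E r) ⟩
  ∣ - (E * r) ∣
    ≡⟨ ∣-p∣≡∣p∣ (E * r) ⟩
  ∣ E * r ∣
    ≡⟨ 0≤p⇒∣p∣≡p (0≤* (remainder-nonNeg (suc k) n) (0≤/ 1 (suc k))) ⟩
  E * r
    ≤⟨ *-monoʳ-≤-nonNeg r {{nonNegative (0≤/ 1 (suc k))}} (remainder-≤ (suc k) n) ⟩
  ι (2 ℕ.* suc k) * X * r
    ≡⟨ swap (ι (2 ℕ.* suc k)) X r ⟩
  ι (2 ℕ.* suc k) * r * X
    ≡⟨ cong (_* X) (fraction-≡ ((2 ℕ.* suc k) ∕ 1 ⊗ 1 ∕ suc k) (2 ∕ 1) (ℕSolver.solve (k ∷ []))) ⟩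
  ι 2 * X ∎
  where
  open ≤-Reasoning
  c = cbw (suc k)
  S = partialSum (suc k) n
  E = remainder (suc k) n
  r = + 1 / suc k
  X = oddH (suc n) * cbw (suc n)
  rearrange : ∀ c S i E r → c * S - (i * c * S + E) * r ≡ c * S * (1ℚ - i * r) - E * r
  rearrange = solve-∀ ℚ-ring
  cancel : ∀ c S E r → c * S * (1ℚ - 1ℚ) - E * r ≡ - (E * r)
  cancel = solve-∀ ℚ-ring
  swap : ∀ i x r → i * x * r ≡ i * r * x
  swap = solve-∀ ℚ-ring

-- For 2^m ≤ t < 2^(m+1) one has h_t ≤ m + 3 and c_t² (2t+1) ≤ 1, and the threshold M
-- makes (K (d+1) (m+3))² < 2^m ≤ t, so that K h_t c_t < 1/(d+1) ≤ ε.
oddH*cbw-vanishing : ∀ K → Vanishing (λ n → ι K * (oddH (suc n) * cbw (suc n)))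
oddH*cbw-vanishing K (mkℚ (+ zero) d _)    (*<* (ℤ.+<+ ()))
oddH*cbw-vanishing K (mkℚ ℤ.-[1+ p ] d _) (*<* ())
oddH*cbw-vanishing K ε@(mkℚ (+ suc p) d _) _ = 2 ℕ.^ M , below-ε
  where
  a = K ℕ.* suc d
  M = 2 ℕ.* (a ℕ.* a) ℕ.+ 8
  below-ε : ∀ n → 2 ℕ.^ M ℕ.≤ n → ι K * (oddH (suc n) * cbw (suc n)) < ε
  below-ε n 2^M≤n with log₂-bracket n
  ... | m , 2^m≤t , t<2^[1+m] = begin-strict
    ι K * (oddH t * cbw t)
      ≤⟨ *-monoˡ-≤-nonNeg (ι K) {{nonNegative (0≤/ K 1)}}
           (*-monoʳ-≤-nonNeg (cbw t) {{nonNegative (cbw-nonNeg t)}} oddH-≤) ⟩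
    ι K * (ι (m ℕ.+ 3) * cbw t)
      ≡⟨ ι*ι*/ K (m ℕ.+ 3) (central t) (4 ℕ.^ t) {{ℕP.m^n≢0 4 t}} ⟩
    (+ (K ℕ.* (m ℕ.+ 3) ℕ.* central t) / 4 ℕ.^ t) {{ℕP.m^n≢0 4 t}}
      <⟨ /-<-cross (K ℕ.* (m ℕ.+ 3) ℕ.* central t) (4 ℕ.^ t) 1 (suc d) {{ℕP.m^n≢0 4 t}} cross ⟩
    + 1 / suc d
      ≤⟨ /-≤-cross 1 (suc d) (suc p) (suc d) (ℕP.*-monoˡ-≤ (suc d) (ℕ.s≤s (ℕ.z≤n {p}))) ⟩
    + suc p / suc d
      ≡⟨ ↥p/↧p≡p ε ⟩
    ε ∎
    where
    open ≤-Reasoning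
    t = suc n
    oddH-≤ : oddH t ≤ ι (m ℕ.+ 3)
    oddH-≤ = ≤-trans (oddH-mono-≤ (ℕP.<⇒≤ t<2^[1+m]))
                     (subst (λ e → oddH (2 ℕ.^ suc m) ≤ ι e) (sym (ℕP.+-suc m 2)) (oddH-2^-≤ (suc m)))
    M≤m : M ℕ.≤ m
    M≤m = ℕP.≮⇒≥ λ m<M → ℕP.<-irrefl refl
      (ℕP.<-≤-trans t<2^[1+m] (ℕP.≤-trans (ℕP.^-monoʳ-≤ 2 m<M) (ℕP.≤-trans 2^M≤n (ℕP.n≤1+n n))))
    cross : K ℕ.* (m ℕ.+ 3) ℕ.* central t ℕ.* suc d ℕ.< 1 ℕ.* 4 ℕ.^ t
    cross = subst₂ ℕ._<_ (regroup K (suc d) (m ℕ.+ 3) (central t)) (sym (ℕP.*-identityˡ (4 ℕ.^ t)))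
                   (*-central<4^ a m t (square-<-2^ (a ℕ.* a) m M≤m) 2^m≤t)
      where
      regroup : ∀ K D b c → K ℕ.* D ℕ.* b ℕ.* c ≡ K ℕ.* b ℕ.* c ℕ.* D
      regroup = ℕSolver.solve-∀

lemma4 : (k : ℕ) → .{{_ : NonZero k}} →
         SumsTo (λ n → cbw k * partialSum k n) (oddH k * (+ 1 / k))
lemma4 (suc k) = SumsTo-dominated (λ n → cbw (suc k) * partialSum (suc k) n) (oddH (suc k) * (+ 1 / suc k))
  (partialSum-deviation-≤ k) (oddH*cbw-vanishing 2)
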